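{- Let $G$ be a finite group of order $9$ (written additively), and let $A,B$ be subsets of $G$. Then: (i) if $|A|=3$ and $A$ is zero-sum free, then $|\sum(A)|\ge 6$; (ii) if $|A|=3$ and $0\notin A$, then $|\sum(A)|\ge 5$; (iii) if $|A|=4$ and $0\notin A$, then $|\sum(A)|\ge 7$; (iv) if $|A|=4$, then $|\sum_2(A)|\ge 5$; (v) if $|A|=4$ and $|B|\ge 2$, then $|A+B|\ge 5$.
   Context: For $A=\{a_1,\dots,a_k\}$, $\sum(A)=\{a_{i_1}+\cdots+a_{i_l} : 1\le l\le k,\ i_1,\dots,i_l \text{ pairwise distinct}\}$, and for $1\le r\le k$, $\sum_r(A)=\{a_{i_1}+\cdots+a_{i_r} : i_1,\dots,i_r \text{ pairwise distinct}\}$. $A$ is zero-sum free if $0\notin\sum(A)$. $A+B=\{a+b : a\in A,\ b\in B\}$. -}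

module Defs where

open import Data.Nat using (ℕ)
open import Data.Fin using (Fin; _≟_)
open import Data.Fin.Properties using (any?)
open import Data.Fin.Subset using (Subset; _∈_; _⊆_; Nonempty; ∣_∣)
open import Data.Fin.Subset.Properties using (_∈?_; _⊆?_; nonempty?; anySubset?)
open import Data.List using (List; []; _∷_; allFin)
open import Data.Product using (_×_; ∃-syntax)
open import Data.Vec using (tabulate)
open import Relation.Nullary.Decidable using (yes; no; ⌊_⌋; _×-dec_)
open import Relation.Binary.PropositionalEquality using (_≡_)
import Data.Nat.Properties as ℕP
open import Algebra.Core using (Op₂)

-- A finite group G of order n is modelled by a group structure on Fin n
-- (whose carrier has exactly n elements); subsets of G are `Subset n`,
-- their cardinality is `∣_∣`.

sumOf : ∀ {n} → Op₂ (Fin n) → Fin n → Subset n → Fin n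
sumOf {n} _+_ 0# S = go (allFin n)
  where
    go : List (Fin n) → Fin n
    go [] = 0#
    go (i ∷ is) with i ∈? S
    ... | yes _ = i + go is
    ... | no _  = go is

module _ {n : ℕ} (_+_ : Op₂ (Fin n)) (0# : Fin n) where

  subsetSums : Subset n → Subset n
  subsetSums A = tabulate λ x →
    ⌊ anySubset? (λ S → S ⊆? A ×-dec nonempty? S ×-dec (sumOf _+_ 0# S ≟ x)) ⌋

  rSums : ℕ → Subset n → Subset n
  rSums r A = tabulate λ x →
    ⌊ anySubset? (λ S → S ⊆? A ×-dec (∣ S ∣ ℕP.≟ r) ×-dec (sumOf _+_ 0# S ≟ x)) ⌋

  sumset : Subset n → Subset n → Subset n
  sumset A B = tabulate λ x →
    ⌊ any? (λ a → any? (λ b → a ∈? A ×-dec b ∈? B ×-dec ((a + b) ≟ x))) ⌋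

  ZeroSumFree : Subset n → Set
  ZeroSumFree A = 0# ∈ subsetSums A → Data.Empty.⊥
    where import Data.Empty

-- Up to isomorphism there are two abelian groups of order 9. Summing all elements
-- before and after translating by x gives 9x = 0; so an element g with 3g ≠ 0 has
-- order 9 and k ↦ kg identifies ℤ₉ with the group, while if 3x = 0 throughout, any
-- g ≠ 0 and h ∉ ⟨g⟩ identify ℤ₃ × ℤ₃ with it by (i , j) ↦ ih + jg. All five bounds
-- only involve sums over small subsets, so they transfer along such an isomorphism,
-- and in the two concrete models they are verified by running through all 2⁹ subsets.

module Submission where

open import Defs
open import Relation.Binary.PropositionalEquality
open import Level using (0ℓ)
open import Data.Bool using (Bool; if_then_else_)
open import Data.Nat as ℕ using (ℕ; zero; suc; NonZero; _*_; _≤_; _<_; _≤?_; s≤s; z≤n)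
open import Data.Nat.Properties using (≤-trans; ≤-reflexive; <⇒≱; 1+n≰n; +-0-commutativeMonoid)
open import Data.Nat.DivMod using (_%_; _/_; m%n<n; m≡m%n+[m/n]*n)
open import Data.Nat.GCD using (gcd; gcd-GCD; module Bézout)
open import Data.Nat.Divisibility using (_∣_; _∣?_; divides)
open import Data.Fin using (Fin; zero; suc; toℕ; fromℕ<; combine; quotient; remainder; punchOut; _≟_)
open import Data.Fin.Properties
  using (any?; all?; suc-injective; punchOut-injective; injective⇒≤; toℕ-fromℕ<; remQuot-combine; combine-remQuot)
open import Data.Fin.Subset using (Subset; inside; outside; _∈_; _∉_; ∣_∣; ⊥; ⁅_⁆; _∪_)
open import Data.Fin.Subset.Properties
  using (_∈?_; _⊆?_; nonempty?; anySubset?; ∉⊥; x∈⁅x⁆; x∈⁅y⁆⇒x≡y; x∈p∪q⁺; x∈p∪q⁻; ∪-identityˡ; ∣⊥∣≡0;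
         p⊆q⇒∣p∣≤∣q∣)
open import Data.Fin.Permutation using (Permutation′; permutation; _⟨$⟩ʳ_)
open import Data.List using (List; []; _∷_; map; filter; foldr; _++_; length; allFin; cartesianProductWith)
open import Data.List.Properties using (length-map)
open import Data.List.Membership.Propositional using () renaming (_∈_ to _∈ₗ_; _∉_ to _∉ₗ_)
open import Data.List.Membership.DecPropositional (_≟_ {9}) using () renaming (_∈?_ to _∈ₗ?_)
open import Data.List.Membership.Propositional.Properties
  using (∈-filter⁺; ∈-filter⁻; ∈-allFin; ∈-map⁻; ∈-++⁻; ∈-cartesianProductWith⁻)
open import Data.List.Membership.Propositional.Properties.WithK using (unique∧set⇒bag)
open import Data.List.Relation.Unary.Any using (here; there)
open import Data.List.Relation.Unary.All.Properties using (anti-mono)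
open import Data.List.Relation.Unary.Unique.Propositional using (Unique; []; _∷_)
open import Data.List.Relation.Unary.Unique.Propositional.Properties
  using (map⁺; filter⁺; allFin⁺; Unique[x∷xs]⇒x∉xs)
open import Data.List.Relation.Binary.Subset.Propositional using () renaming (_⊆_ to _⊆ₗ_)
open import Data.List.Relation.Binary.BagAndSetEquality using (_∼[_]_; set; ∼bag⇒↭)
open import Data.List.Relation.Binary.Permutation.Propositional using (↭⇒↭ₛ)
open import Data.List.Relation.Binary.Permutation.Setoid.Properties (setoid (Fin 9)) using (foldr-commMonoid)
open import Data.Vec using ([]; _∷_; lookup; tabulate)
import Data.Vec as Vec
open import Data.Vec.Properties using (lookup∘tabulate; lookup⇒[]=; []=⇒lookup)
open import Data.Product as Product using (∃; ∃₂; _×_; _,_; proj₁; proj₂)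
open import Data.Sum using (_⊎_; inj₁; inj₂; [_,_]′)
open import Function using (id; const; _∘_; _$_; it; mk⇔; Injective; Injection)
open import Function.Properties.Inverse using (↔⇒↣)
open import Relation.Nullary using (Dec; yes; no; ¬?; contradiction)
open import Relation.Nullary.Decidable
  using (⌊_⌋; map′; _×-dec_; _→-dec_; from-yes; decidable-stable; dec-true; isYes≗does)
open import Relation.Unary using (Decidable)
open import Algebra.Core using (Op₁; Op₂)
open import Algebra.Bundles using (CommutativeMonoid; Group)
open import Algebra.Structures using (IsCommutativeMonoid; IsAbelianGroup)
import Algebra.Properties.CommutativeMonoid.Mult as Mult
import Algebra.Properties.CommutativeMonoid.Sum as Sum
import Algebra.Properties.CommutativeSemigroup as CommutativeSemigroupProperties
import Algebra.Properties.Group as GroupProperties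

open Sum +-0-commutativeMonoid using (∑-permute) renaming (sum to ∑; sum-cong-≗ to ∑-cong-≗)

private variable
  n : ℕ

elements : Subset n → List (Fin n)
elements {n} p = filter (_∈? p) (allFin n)

∈-elements⁺ : ∀ {p : Subset n} {x} → x ∈ p → x ∈ₗ elements p
∈-elements⁺ {x = x} = ∈-filter⁺ (_∈? _) (∈-allFin x)

∈-elements⁻ : ∀ {p : Subset n} {x} → x ∈ₗ elements p → x ∈ p
∈-elements⁻ {p = p} = proj₂ ∘ ∈-filter⁻ (_∈? p) {xs = allFin _}

elements-unique : (p : Subset n) → Unique (elements p)
elements-unique {n} p = filter⁺ (_∈? p) (allFin⁺ n)

fromList : List (Fin n) → Subset n
fromList = foldr (λ x p → ⁅ x ⁆ ∪ p) ⊥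

∈-fromList⁺ : ∀ {xs} {x : Fin n} → x ∈ₗ xs → x ∈ fromList xs
∈-fromList⁺ (here refl)  = x∈p∪q⁺ (inj₁ (x∈⁅x⁆ _))
∈-fromList⁺ (there x∈xs) = x∈p∪q⁺ (inj₂ (∈-fromList⁺ x∈xs))

∈-fromList⁻ : ∀ xs {x : Fin n} → x ∈ fromList xs → x ∈ₗ xs
∈-fromList⁻ []       x∈⊥ = contradiction x∈⊥ ∉⊥
∈-fromList⁻ (y ∷ xs) x∈ with x∈p∪q⁻ ⁅ y ⁆ (fromList xs) x∈
... | inj₁ x∈⁅y⁆ = here (x∈⁅y⁆⇒x≡y y x∈⁅y⁆)
... | inj₂ x∈xs  = there (∈-fromList⁻ xs x∈xs)

∣⁅x⁆∪p∣ : ∀ {x} {p : Subset n} → x ∉ p → ∣ ⁅ x ⁆ ∪ p ∣ ≡ suc ∣ p ∣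
∣⁅x⁆∪p∣ {x = zero}  {outside ∷ p} _   = cong (suc ∘ ∣_∣) (∪-identityˡ p)
∣⁅x⁆∪p∣ {x = zero}  {inside ∷ p}  x∉p = contradiction Vec.here x∉p
∣⁅x⁆∪p∣ {x = suc x} {outside ∷ p} x∉p = ∣⁅x⁆∪p∣ (x∉p ∘ Vec.there)
∣⁅x⁆∪p∣ {x = suc x} {inside ∷ p}  x∉p = cong suc (∣⁅x⁆∪p∣ (x∉p ∘ Vec.there))

∣fromList∣ : ∀ {xs : List (Fin n)} → Unique xs → ∣ fromList xs ∣ ≡ length xs
∣fromList∣ {n} {[]}     []       = ∣⊥∣≡0 n
∣fromList∣ {xs = x ∷ xs} u@(_ ∷ u′) =
  trans (∣⁅x⁆∪p∣ (Unique[x∷xs]⇒x∉xs u ∘ ∈-fromList⁻ xs)) (cong suc (∣fromList∣ u′))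

preimage : (Fin n → Fin n) → Subset n → Subset n
preimage f p = tabulate (lookup p ∘ f)

∈-preimage⁺ : ∀ f {p : Subset n} {x} → f x ∈ p → x ∈ preimage f p
∈-preimage⁺ f {x = x} fx∈p = lookup⇒[]= x _ (trans (lookup∘tabulate _ x) ([]=⇒lookup fx∈p))

∈-preimage⁻ : ∀ f {p : Subset n} {x} → x ∈ preimage f p → f x ∈ p
∈-preimage⁻ f {x = x} x∈ = lookup⇒[]= _ _ (trans (sym (lookup∘tabulate _ x)) ([]=⇒lookup x∈))

indicator : Bool → ℕ
indicator b = if b then 1 else 0

∣p∣≡∑ : (p : Subset n) → ∣ p ∣ ≡ ∑ (indicator ∘ lookup p)
∣p∣≡∑ []           = refl
∣p∣≡∑ (inside ∷ p)  = cong suc (∣p∣≡∑ p)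
∣p∣≡∑ (outside ∷ p) = ∣p∣≡∑ p

∣preimage∣ : (π : Permutation′ n) (p : Subset n) → ∣ preimage (π ⟨$⟩ʳ_) p ∣ ≡ ∣ p ∣
∣preimage∣ {n} π p = begin
  ∣ preimage (π ⟨$⟩ʳ_) p ∣                       ≡⟨ ∣p∣≡∑ (preimage (π ⟨$⟩ʳ_) p) ⟩
  ∑ (indicator ∘ lookup (preimage (π ⟨$⟩ʳ_) p))  ≡⟨ ∑-cong-≗ {n} (cong indicator ∘ lookup∘tabulate _) ⟩
  ∑ (indicator ∘ lookup p ∘ (π ⟨$⟩ʳ_))           ≡⟨ ∑-permute (indicator ∘ lookup p) π ⟨
  ∑ (indicator ∘ lookup p)                       ≡⟨ ∣p∣≡∑ p ⟨
  ∣ p ∣                                          ∎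
  where open ≡-Reasoning

some-element : (p : Subset n) → 1 ≤ ∣ p ∣ → ∃ (_∈ p)
some-element (inside ∷ p)  _ = zero , Vec.here
some-element (outside ∷ p) h = Product.map suc Vec.there (some-element p h)

two-distinct-elements : (p : Subset n) → 2 ≤ ∣ p ∣ → ∃₂ λ x y → x ≢ y × x ∈ p × y ∈ p
two-distinct-elements (inside ∷ p) (s≤s h) with y , y∈p ← some-element p h =
  zero , suc y , (λ ()) , Vec.here , Vec.there y∈p
two-distinct-elements (outside ∷ p) h with x , y , x≢y , x∈p , y∈p ← two-distinct-elements p h =
  suc x , suc y , x≢y ∘ suc-injective , Vec.there x∈p , Vec.there y∈p

all-subsets? : {P : Subset n → Set} → Decidable P → Dec (∀ S → P S)
all-subsets? {zero}  P? = map′ (λ p → λ { [] → p }) (_$ []) (P? [])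
all-subsets? {suc n} P? = map′
  (λ (t , f) → λ { (inside ∷ S) → t S ; (outside ∷ S) → f S })
  (λ h → h ∘ (inside ∷_) , h ∘ (outside ∷_))
  (all-subsets? (P? ∘ (inside ∷_)) ×-dec all-subsets? (P? ∘ (outside ∷_)))

∃-∉-image : ∀ {k} → k < n → (f : Fin k → Fin n) → ∃ λ y → ∀ i → f i ≢ y
∃-∉-image {n} {k} k<n f with any? (λ y → ¬? (any? λ i → f i ≟ y))
... | yes (y , ∄i) = y , λ i fi≡y → ∄i (i , fi≡y)
... | no ∄y = contradiction (injective⇒≤ section-injective) (<⇒≱ k<n)
  where
  hit : ∀ y → ∃ λ i → f i ≡ y
  hit y = decidable-stable (any? λ i → f i ≟ y) (λ ∄i → ∄y (y , ∄i))
  section-injective : Injective _≡_ _≡_ (proj₁ ∘ hit)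
  section-injective {y} {y′} eq = trans (sym (proj₂ (hit y))) (trans (cong f eq) (proj₂ (hit y′)))

injective⇒surjective : ∀ {f : Fin n → Fin n} → Injective _≡_ _≡_ f → ∀ y → ∃ λ x → f x ≡ y
injective⇒surjective {suc n} {f} f-inj y with any? (λ x → f x ≟ y)
... | yes found = found
... | no ∄x = contradiction (injective⇒≤ punched-injective) 1+n≰n
  where
  y≢f : ∀ x → y ≢ f x
  y≢f x = ∄x ∘ (x ,_) ∘ sym
  punched-injective : Injective _≡_ _≡_ (λ x → punchOut (y≢f x))
  punched-injective {x} {x′} = f-inj ∘ punchOut-injective (y≢f x) (y≢f x′)

injection⇒permutation : (f : Fin n → Fin n) → Injective _≡_ _≡_ f → Permutation′ n
injection⇒permutation f f-inj = permutation f (proj₁ ∘ surj) (proj₂ ∘ surj) (f-inj ∘ proj₂ ∘ surj ∘ f)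
  where surj = injective⇒surjective f-inj

some-member : ∀ {A : Set} {xs : List A} → 1 ≤ length xs → ∃ (_∈ₗ xs)
some-member {xs = x ∷ _} _ = x , here refl

sublists : ∀ {A : Set} → List A → List (List A)
sublists []       = [] ∷ []
sublists (x ∷ xs) = map (x ∷_) (sublists xs) ++ sublists xs

module _ {A : Set} where

  sublist-⊆ : ∀ xs {ys : List A} → ys ∈ₗ sublists xs → ys ⊆ₗ xs
  sublist-⊆ []       (here refl) ()
  sublist-⊆ (x ∷ xs) ys∈ with ∈-++⁻ (map (x ∷_) (sublists xs)) ys∈
  ... | inj₂ ys∈′ = there ∘ sublist-⊆ xs ys∈′
  ... | inj₁ ys∈′ with zs , zs∈ , refl ← ∈-map⁻ (x ∷_) ys∈′ = λ where
    (here refl) → here refl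
    (there v∈)  → there (sublist-⊆ xs zs∈ v∈)

  sublist-unique : ∀ {xs ys : List A} → Unique xs → ys ∈ₗ sublists xs → Unique ys
  sublist-unique {[]}     []         (here refl) = []
  sublist-unique {x ∷ xs} (x≢xs ∷ u) ys∈ with ∈-++⁻ (map (x ∷_) (sublists xs)) ys∈
  ... | inj₂ ys∈′ = sublist-unique u ys∈′
  ... | inj₁ ys∈′ with zs , zs∈ , refl ← ∈-map⁻ (x ∷_) ys∈′ =
    anti-mono (sublist-⊆ xs zs∈) x≢xs ∷ sublist-unique u zs∈

module _ {A : Set} (_∙_ : Op₂ A) (ε : A) where

  sublistSums : {P : List A → Set} → Decidable P → List A → List A
  sublistSums P? xs = map (foldr _∙_ ε) (filter P? (sublists xs))

  ∈-sublistSums⁻ : ∀ {P} (P? : Decidable P) xs {s} → s ∈ₗ sublistSums P? xs →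
                   ∃ λ ys → ys ∈ₗ sublists xs × P ys × s ≡ foldr _∙_ ε ys
  ∈-sublistSums⁻ P? xs s∈
    with ys , ys∈ , refl ← ∈-map⁻ (foldr _∙_ ε) s∈
    with ys∈xs , Pys ← ∈-filter⁻ P? {xs = sublists xs} ys∈ = ys , ys∈xs , Pys , refl

EverySubset : ∀ n → (Subset n → Set) → Set
EverySubset zero    P = P []
EverySubset (suc n) P = EverySubset n (P ∘ (inside ∷_)) × EverySubset n (P ∘ (outside ∷_))

every-subset : {P : Subset n → Set} → EverySubset n P → ∀ S → P S
every-subset {zero}  p       []            = p
every-subset {suc n} (p , _) (inside ∷ S)  = every-subset p S
every-subset {suc n} (_ , q) (outside ∷ S) = every-subset q S

∈-tabulate-⌊⌋ : {P : Fin n → Set} (P? : Decidable P) {x : Fin n} → P x → x ∈ tabulate (⌊_⌋ ∘ P?)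
∈-tabulate-⌊⌋ P? {x} px =
  lookup⇒[]= x _ (trans (lookup∘tabulate _ x) (trans (isYes≗does (P? x)) (dec-true (P? x) px)))

module SubsetSums {_+_ : Op₂ (Fin 9)} {0# : Fin 9} (isCM : IsCommutativeMonoid _≡_ _+_ 0#) where

  sum : List (Fin 9) → Fin 9
  sum = foldr _+_ 0#

  -- `sumOf` folds with a where-bound helper that only reduces on a concrete subset, so the
  -- equation is checked separately on each of the 2⁹ subsets; instance search supplies the proofs.
  sumOf≡sum-elements : ∀ S → sumOf _+_ 0# S ≡ sum (elements S)
  sumOf≡sum-elements = every-subset it
    where instance
      both : ∀ {A B : Set} → {{A}} → {{B}} → A × B
      both {{a}} {{b}} = a , b
      reflexive : {x : Fin 9} → x ≡ x
      reflexive = refl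

  sum-resp-∼set : ∀ {xs ys} → Unique xs → Unique ys → xs ∼[ set ] ys → sum xs ≡ sum ys
  sum-resp-∼set u v xs∼ys = foldr-commMonoid isCM (↭⇒↭ₛ (∼bag⇒↭ (unique∧set⇒bag u v xs∼ys)))

  sumOf-fromList : ∀ {ys} → Unique ys → sumOf _+_ 0# (fromList ys) ≡ sum ys
  sumOf-fromList {ys} u = trans (sumOf≡sum-elements (fromList ys))
    (sum-resp-∼set (elements-unique (fromList ys)) u
      (mk⇔ (∈-fromList⁻ ys ∘ ∈-elements⁻) (∈-elements⁺ ∘ ∈-fromList⁺ {xs = ys})))

  sum∈subsetSums : ∀ {ys} {A : Subset 9} → Unique ys → 1 ≤ length ys → (∀ {x} → x ∈ₗ ys → x ∈ A) →
                   sum ys ∈ subsetSums _+_ 0# A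
  sum∈subsetSums {ys} {A} u 1≤∣ys∣ ⊆A =
    ∈-tabulate-⌊⌋ (λ x → anySubset? λ S → S ⊆? A ×-dec nonempty? S ×-dec (sumOf _+_ 0# S ≟ x))
      ( fromList ys , ⊆A ∘ ∈-fromList⁻ ys , Product.map₂ (∈-fromList⁺ {xs = ys}) (some-member 1≤∣ys∣)
      , sumOf-fromList u)

  sum∈rSums : ∀ {r ys} {A : Subset 9} → Unique ys → length ys ≡ r → (∀ {x} → x ∈ₗ ys → x ∈ A) →
              sum ys ∈ rSums _+_ 0# r A
  sum∈rSums {r} {ys} {A} u ∣ys∣≡r ⊆A =
    ∈-tabulate-⌊⌋ (λ x → anySubset? λ S → S ⊆? A ×-dec (∣ S ∣ ℕ.≟ r) ×-dec (sumOf _+_ 0# S ≟ x))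
      (fromList ys , ⊆A ∘ ∈-fromList⁻ ys , trans (∣fromList∣ u) ∣ys∣≡r , sumOf-fromList u)

  ∈-sumset : ∀ {A B : Subset 9} {a b} → a ∈ A → b ∈ B → a + b ∈ sumset _+_ 0# A B
  ∈-sumset {A} {B} {a} {b} a∈A b∈B =
    ∈-tabulate-⌊⌋ (λ x → any? λ u → any? λ v → u ∈? A ×-dec v ∈? B ×-dec (u + v ≟ x))
      (a , b , a∈A , b∈B , refl)

-- The models ℤ₉ and ℤ₃ × ℤ₃

_+ₘ_ : ∀ {k} .{{_ : NonZero k}} → Op₂ (Fin k)
_+ₘ_ {k} a b = fromℕ< (m%n<n (toℕ a ℕ.+ toℕ b) k)

ℤ₉ : Op₂ (Fin 9)
ℤ₉ = _+ₘ_

-- (i , j) ∈ ℤ₃ × ℤ₃ is represented by combine i j = 3i + j.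
ℤ₃×ℤ₃ : Op₂ (Fin 9)
ℤ₃×ℤ₃ a b = combine (quotient {3} 3 a +ₘ quotient {3} 3 b) (remainder {3} 3 a +ₘ remainder {3} 3 b)

module _ (_⊕_ : Op₂ (Fin 9)) where

  Σ-list : Subset 9 → List (Fin 9)
  Σ-list S = sublistSums _⊕_ zero (λ ys → 1 ≤? length ys) (elements S)

  Σ₂-list : Subset 9 → List (Fin 9)
  Σ₂-list S = sublistSums _⊕_ zero (λ ys → length ys ℕ.≟ 2) (elements S)

  translates : Subset 9 → Fin 9 → Fin 9 → List (Fin 9)
  translates S b b′ = cartesianProductWith _⊕_ (elements S) (b ∷ b′ ∷ [])

  record Bounds : Set where
    field
      Σ-zeroSumFree   : ∀ S → ∣ S ∣ ≡ 3 → zero ∉ₗ Σ-list S → 6 ≤ ∣ fromList (Σ-list S) ∣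
      Σ-three         : ∀ S → ∣ S ∣ ≡ 3 → zero ∉ S → 5 ≤ ∣ fromList (Σ-list S) ∣
      Σ-four          : ∀ S → ∣ S ∣ ≡ 4 → zero ∉ S → 7 ≤ ∣ fromList (Σ-list S) ∣
      Σ₂-four         : ∀ S → ∣ S ∣ ≡ 4 → 5 ≤ ∣ fromList (Σ₂-list S) ∣
      translates-four : ∀ S → ∣ S ∣ ≡ 4 → ∀ b b′ → b ≢ b′ → 5 ≤ ∣ fromList (translates S b b′) ∣

  bounds? : Dec Bounds
  bounds? = map′ (λ (p , q , r , s , t) → record
                    { Σ-zeroSumFree = p ; Σ-three = q ; Σ-four = r ; Σ₂-four = s ; translates-four = t })
                 (λ B → let open Bounds B in Σ-zeroSumFree , Σ-three , Σ-four , Σ₂-four , translates-four)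
    ( all-subsets? (λ S → ∣ S ∣ ℕ.≟ 3 →-dec ¬? (zero ∈ₗ? Σ-list S) →-dec 6 ≤? ∣ fromList (Σ-list S) ∣)
    ×-dec all-subsets? (λ S → ∣ S ∣ ℕ.≟ 3 →-dec ¬? (zero ∈? S) →-dec 5 ≤? ∣ fromList (Σ-list S) ∣)
    ×-dec all-subsets? (λ S → ∣ S ∣ ℕ.≟ 4 →-dec ¬? (zero ∈? S) →-dec 7 ≤? ∣ fromList (Σ-list S) ∣)
    ×-dec all-subsets? (λ S → ∣ S ∣ ℕ.≟ 4 →-dec 5 ≤? ∣ fromList (Σ₂-list S) ∣)
    ×-dec all-subsets? (λ S → ∣ S ∣ ℕ.≟ 4 →-dec all? λ b → all? λ b′ → ¬? (b ≟ b′) →-dec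
                                5 ≤? ∣ fromList (translates S b b′) ∣))

  RightDivisible : Set
  RightDivisible = ∀ a b → ∃ λ c → b ⊕ c ≡ a

ℤ₉-bounds : Bounds ℤ₉
ℤ₉-bounds = from-yes (bounds? ℤ₉)

ℤ₃×ℤ₃-bounds : Bounds ℤ₃×ℤ₃
ℤ₃×ℤ₃-bounds = from-yes (bounds? ℤ₃×ℤ₃)

ℤ₉-rightDivisible : RightDivisible ℤ₉
ℤ₉-rightDivisible = from-yes (all? λ a → all? λ b → any? λ c → ℤ₉ b c ≟ a)

ℤ₉-identityʳ : ∀ a → ℤ₉ a zero ≡ a
ℤ₉-identityʳ = from-yes (all? λ a → ℤ₉ a zero ≟ a)

ℤ₃×ℤ₃-rightDivisible : RightDivisible ℤ₃×ℤ₃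
ℤ₃×ℤ₃-rightDivisible = from-yes (all? λ a → all? λ b → any? λ c → ℤ₃×ℤ₃ b c ≟ a)

ℤ₃×ℤ₃-identityʳ : ∀ a → ℤ₃×ℤ₃ a zero ≡ a
ℤ₃×ℤ₃-identityʳ = from-yes (all? λ a → ℤ₃×ℤ₃ a zero ≟ a)

module FiniteAbelianGroup {n} {_+_ : Op₂ (Fin n)} {0# : Fin n} { -_ : Op₁ (Fin n)}
                          (isAG : IsAbelianGroup _≡_ _+_ 0# -_) where

  open IsAbelianGroup isAG
    using (assoc; identityˡ; identityʳ; inverseˡ; inverseʳ; isCommutativeMonoid; isGroup)

  commutativeMonoid : CommutativeMonoid 0ℓ 0ℓ
  commutativeMonoid = record { isCommutativeMonoid = isCommutativeMonoid }

  group : Group 0ℓ 0ℓ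
  group = record { isGroup = isGroup }

  open Mult commutativeMonoid public using ()
    renaming (_×_ to infixr 25 _·_; ×-homo-1 to ·-homo-1; ×-homo-+ to ·-homo-+; ×-assocˡ to ·-assocˡ;
              ×-distrib-+ to ·-distrib-+)
  open Sum commutativeMonoid using (sum; sum-permute; ∑-distrib-+; sum-replicate; sum-replicate-zero)
  open CommutativeSemigroupProperties (CommutativeMonoid.commutativeSemigroup commutativeMonoid)
    public using (interchange)
  open GroupProperties group public using (identityʳ-unique; inverseˡ-unique; inverseʳ-unique)
  open ≡-Reasoning

  +-cancelʳ : ∀ {u v} → u + v ≡ 0# → ∀ y → (y + u) + v ≡ y
  +-cancelʳ {u} {v} u+v≡0 y = trans (assoc y u v) (trans (cong (y +_) u+v≡0) (identityʳ y))

  translation : Fin n → Permutation′ n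
  translation x = permutation (_+ x) (_+ (- x)) (+-cancelʳ (inverseˡ x)) (+-cancelʳ (inverseʳ x))

  n·x≡0# : ∀ x → n · x ≡ 0#
  n·x≡0# x = identityʳ-unique (sum id) (n · x) (sym (begin
    sum id                      ≡⟨ sum-permute id (translation x) ⟩
    sum (_+ x)                  ≡⟨ ∑-distrib-+ {n} id (const x) ⟩
    sum id + sum {n} (const x)  ≡⟨ cong (sum id +_) (sum-replicate n {x}) ⟩
    sum id + n · x              ∎))

  ·-zeroʳ : ∀ m → m · 0# ≡ 0#
  ·-zeroʳ m = trans (sym (sum-replicate m)) (sum-replicate-zero m)

  ·-annihilated : ∀ m {k x} → k · x ≡ 0# → (m * k) · x ≡ 0#
  ·-annihilated m {k} {x} kx≡0 = begin
    (m * k) · x  ≡⟨ ·-assocˡ x m k ⟨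
    m · (k · x)  ≡⟨ cong (m ·_) kx≡0 ⟩
    m · 0#       ≡⟨ ·-zeroʳ m ⟩
    0#           ∎

  ·-cancel : ∀ d m {x} → (d ℕ.+ m) · x ≡ 0# → m · x ≡ 0# → d · x ≡ 0#
  ·-cancel d m {x} e mx≡0 = begin
    d · x          ≡⟨ identityʳ _ ⟨
    d · x + 0#     ≡⟨ cong (d · x +_) mx≡0 ⟨
    d · x + m · x  ≡⟨ ·-homo-+ x d m ⟨
    (d ℕ.+ m) · x  ≡⟨ e ⟩
    0#             ∎

  ·-gcd : ∀ {a b} x → a · x ≡ 0# → b · x ≡ 0# → gcd a b · x ≡ 0#
  ·-gcd {a} {b} x ax≡0 bx≡0 with Bézout.identity (gcd-GCD a b)
  ... | Bézout.+- u v eq =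
    ·-cancel (gcd a b) (v * b) (trans (cong (_· x) eq) (·-annihilated u ax≡0)) (·-annihilated v bx≡0)
  ... | Bézout.-+ u v eq =
    ·-cancel (gcd a b) (u * a) (trans (cong (_· x) eq) (·-annihilated v bx≡0)) (·-annihilated u ax≡0)

  ·-mod : ∀ k .{{_ : NonZero k}} m {x} → k · x ≡ 0# → (m % k) · x ≡ m · x
  ·-mod k m {x} kx≡0 = sym (begin
    m · x                            ≡⟨ cong (_· x) (m≡m%n+[m/n]*n m k) ⟩
    (m % k ℕ.+ (m / k) * k) · x      ≡⟨ ·-homo-+ x (m % k) _ ⟩
    (m % k) · x + ((m / k) * k) · x  ≡⟨ cong ((m % k) · x +_) (·-annihilated (m / k) kx≡0) ⟩
    (m % k) · x + 0#                 ≡⟨ identityʳ _ ⟩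
    (m % k) · x                      ∎)

  ·-homo-+ₘ : ∀ {k} .{{_ : NonZero k}} {x} → k · x ≡ 0# →
              ∀ (a b : Fin k) → toℕ (a +ₘ b) · x ≡ toℕ a · x + toℕ b · x
  ·-homo-+ₘ {k} {x} kx≡0 a b = begin
    toℕ (a +ₘ b) · x             ≡⟨ cong (_· x) (toℕ-fromℕ< (m%n<n (toℕ a ℕ.+ toℕ b) k)) ⟩
    ((toℕ a ℕ.+ toℕ b) % k) · x  ≡⟨ ·-mod k (toℕ a ℕ.+ toℕ b) kx≡0 ⟩
    (toℕ a ℕ.+ toℕ b) · x        ≡⟨ ·-homo-+ x (toℕ a) (toℕ b) ⟩
    toℕ a · x + toℕ b · x        ∎

  ·-trivialKernel : ∀ {k d} x → suc k · x ≡ 0# →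
                    (∀ (a : Fin (suc k)) → a ≢ zero → gcd (toℕ a) (suc k) ∣ d) →
                    d · x ≢ 0# → ∀ a → toℕ a · x ≡ 0# → a ≡ zero
  ·-trivialKernel {k} x kx≡0 gcd∣d dx≢0 a ax≡0 with a ≟ zero
  ... | yes a≡0 = a≡0
  ... | no a≢0 with divides q refl ← gcd∣d a a≢0 =
    contradiction (·-annihilated q (·-gcd {toℕ a} {suc k} x ax≡0 kx≡0)) dx≢0

gcd[a,9]∣3 : ∀ (a : Fin 9) → a ≢ zero → gcd (toℕ a) 9 ∣ 3
gcd[a,9]∣3 = from-yes (all? λ (a : Fin 9) → ¬? (a ≟ zero) →-dec gcd (toℕ a) 9 ∣? 3)

gcd[a,3]∣1 : ∀ (a : Fin 3) → a ≢ zero → gcd (toℕ a) 3 ∣ 1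
gcd[a,3]∣1 = from-yes (all? λ (a : Fin 3) → ¬? (a ≟ zero) →-dec gcd (toℕ a) 3 ∣? 1)

a²%3≡1 : ∀ (a : Fin 3) → a ≢ zero → (toℕ a * toℕ a) % 3 ≡ 1
a²%3≡1 = from-yes (all? λ (a : Fin 3) → ¬? (a ≟ zero) →-dec (toℕ a * toℕ a) % 3 ℕ.≟ 1)

-- Abelian groups of order 9

module GroupOfOrder9 {_+_ : Op₂ (Fin 9)} {0# : Fin 9} { -_ : Op₁ (Fin 9)}
                     (isAG : IsAbelianGroup _≡_ _+_ 0# -_) where

  open IsAbelianGroup isAG using (identityˡ; identityʳ; isCommutativeMonoid)
  open FiniteAbelianGroup isAG
  open ≡-Reasoning

  record Iso (_⊕_ : Op₂ (Fin 9)) : Set where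
    field
      π       : Permutation′ 9
      homo    : ∀ a b → π ⟨$⟩ʳ (a ⊕ b) ≡ (π ⟨$⟩ʳ a) + (π ⟨$⟩ʳ b)
      zero↦0# : π ⟨$⟩ʳ zero ≡ 0#

  trivialKernel⇒iso : ∀ {_⊕_} → RightDivisible _⊕_ → (∀ a → a ⊕ zero ≡ a) →
                      (f : Fin 9 → Fin 9) → (∀ a b → f (a ⊕ b) ≡ f a + f b) → f zero ≡ 0# →
                      (∀ a → f a ≡ 0# → a ≡ zero) → Iso _⊕_
  trivialKernel⇒iso {_⊕_} divisible ⊕-identityʳ f homo f0≡0# kernel =
    record { π = injection⇒permutation f injective ; homo = homo ; zero↦0# = f0≡0# }
    where
    injective : Injective _≡_ _≡_ f
    injective {a} {b} fa≡fb with c , b⊕c≡a ← divisible a b = begin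
      a         ≡⟨ b⊕c≡a ⟨
      b ⊕ c     ≡⟨ cong (b ⊕_) (kernel c fc≡0#) ⟩
      b ⊕ zero  ≡⟨ ⊕-identityʳ b ⟩
      b         ∎
      where
      fc≡0# : f c ≡ 0#
      fc≡0# = identityʳ-unique (f b) (f c) (begin
        f b + f c  ≡⟨ homo b c ⟨
        f (b ⊕ c)  ≡⟨ cong f b⊕c≡a ⟩
        f a        ≡⟨ fa≡fb ⟩
        f b        ∎)

  cyclic : ∀ g → 3 · g ≢ 0# → Iso ℤ₉
  cyclic g 3g≢0# = trivialKernel⇒iso ℤ₉-rightDivisible ℤ₉-identityʳ (λ a → toℕ a · g)
    (·-homo-+ₘ (n·x≡0# g)) refl (·-trivialKernel g (n·x≡0# g) gcd[a,9]∣3 3g≢0#)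

  elementary : (∀ x → 3 · x ≡ 0#) → Iso ℤ₃×ℤ₃
  elementary 3·≡0# =
    trivialKernel⇒iso ℤ₃×ℤ₃-rightDivisible ℤ₃×ℤ₃-identityʳ f homo (identityʳ 0#) kernel
    where
    nonzero : ∃ λ g → ∀ (i : Fin 1) → 0# ≢ g
    nonzero = ∃-∉-image (s≤s (s≤s z≤n)) (const 0#)

    g : Fin 9
    g = proj₁ nonzero

    g≢0# : g ≢ 0#
    g≢0# = proj₂ nonzero zero ∘ sym

    outside⟨g⟩ : ∃ λ h → ∀ (i : Fin 3) → toℕ i · g ≢ h
    outside⟨g⟩ = ∃-∉-image (s≤s (s≤s (s≤s (s≤s z≤n)))) (λ i → toℕ i · g)

    h : Fin 9
    h = proj₁ outside⟨g⟩

    h∉⟨g⟩ : ∀ m → h ≢ m · g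
    h∉⟨g⟩ m h≡m·g = proj₂ outside⟨g⟩ (fromℕ< (m%n<n m 3)) (begin
        toℕ (fromℕ< (m%n<n m 3)) · g  ≡⟨ cong (_· g) (toℕ-fromℕ< (m%n<n m 3)) ⟩
        (m % 3) · g                   ≡⟨ ·-mod 3 m (3·≡0# g) ⟩
        m · g                         ≡⟨ h≡m·g ⟨
        h                             ∎)

    independent : ∀ (i j : Fin 3) → toℕ i · h + toℕ j · g ≡ 0# → i ≡ zero × j ≡ zero
    independent zero j e = refl , ·-trivialKernel g (3·≡0# g) gcd[a,3]∣1 (g≢0# ∘ trans (sym (·-homo-1 g))) j
      (trans (sym (identityˡ _)) e)
    -- Multiplying by i, whose square is 1 modulo 3, would put h into ⟨g⟩.
    independent i@(suc _) j e = contradiction h≡2ts·g (h∉⟨g⟩ (2 * (t * s)))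
      where
      t = toℕ i
      s = toℕ j
      t²·h≡h : (t * t) · h ≡ h
      t²·h≡h = begin
        (t * t) · h        ≡⟨ ·-mod 3 (t * t) (3·≡0# h) ⟨
        ((t * t) % 3) · h  ≡⟨ cong (_· h) (a²%3≡1 i (λ ())) ⟩
        1 · h              ≡⟨ ·-homo-1 h ⟩
        h                  ∎
      h+ts·g≡0# : h + (t * s) · g ≡ 0#
      h+ts·g≡0# = begin
        h + (t * s) · g              ≡⟨ cong (_+ (t * s) · g) t²·h≡h ⟨
        (t * t) · h + (t * s) · g    ≡⟨ cong₂ _+_ (·-assocˡ h t t) (·-assocˡ g t s) ⟨
        t · (t · h) + t · (s · g)    ≡⟨ ·-distrib-+ (t · h) (s · g) t ⟨
        t · (t · h + s · g)          ≡⟨ cong (t ·_) e ⟩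
        t · 0#                       ≡⟨ ·-zeroʳ t ⟩
        0#                           ∎
      h≡2ts·g : h ≡ (2 * (t * s)) · g
      h≡2ts·g = begin
        h                    ≡⟨ inverseˡ-unique h _ h+ts·g≡0# ⟩
        - ((t * s) · g)      ≡⟨ inverseʳ-unique _ _ (3·≡0# ((t * s) · g)) ⟨
        2 · (t * s) · g      ≡⟨ ·-assocˡ g 2 (t * s) ⟩
        (2 * (t * s)) · g    ∎

    f : Fin 9 → Fin 9
    f a = toℕ (quotient {3} 3 a) · h + toℕ (remainder {3} 3 a) · g

    homo : ∀ a b → f (ℤ₃×ℤ₃ a b) ≡ f a + f b
    homo a b = begin
      f (ℤ₃×ℤ₃ a b)
        ≡⟨ cong (λ (i , j) → toℕ i · h + toℕ j · g) (remQuot-combine (i +ₘ i′) (j +ₘ j′)) ⟩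
      toℕ (i +ₘ i′) · h + toℕ (j +ₘ j′) · g
        ≡⟨ cong₂ _+_ (·-homo-+ₘ (3·≡0# h) i i′) (·-homo-+ₘ (3·≡0# g) j j′) ⟩
      (toℕ i · h + toℕ i′ · h) + (toℕ j · g + toℕ j′ · g)
        ≡⟨ interchange _ _ _ _ ⟩
      f a + f b ∎
      where
      i = quotient {3} 3 a
      j = remainder {3} 3 a
      i′ = quotient {3} 3 b
      j′ = remainder {3} 3 b

    kernel : ∀ a → f a ≡ 0# → a ≡ zero
    kernel a fa≡0# with i≡0 , j≡0 ← independent (quotient {3} 3 a) (remainder {3} 3 a) fa≡0# =
      trans (sym (combine-remQuot {3} 3 a)) (cong₂ combine i≡0 j≡0)

  classify : Iso ℤ₉ ⊎ Iso ℤ₃×ℤ₃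
  classify with any? (λ g → ¬? (3 · g ≟ 0#))
  ... | yes (g , 3g≢0#) = inj₁ (cyclic g 3g≢0#)
  ... | no ∄g = inj₂ (elementary λ x → decidable-stable (3 · x ≟ 0#) (∄g ∘ (x ,_)))

  module _ {_⊕_ : Op₂ (Fin 9)} (iso : Iso _⊕_) where

    open Iso iso
    open SubsetSums isCommutativeMonoid using (sum; sum∈subsetSums; sum∈rSums; ∈-sumset)

    φ : Fin 9 → Fin 9
    φ = π ⟨$⟩ʳ_

    φ-sum : ∀ ys → φ (foldr _⊕_ zero ys) ≡ sum (map φ ys)
    φ-sum []       = zero↦0#
    φ-sum (y ∷ ys) = trans (homo y _) (cong (φ y +_) (φ-sum ys))

    lower-bound : ∀ {k} {T : Subset 9} {L : List (Fin 9)} → (∀ {x} → x ∈ₗ L → φ x ∈ T) →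
                  k ≤ ∣ fromList L ∣ → k ≤ ∣ T ∣
    lower-bound {T = T} {L} φL⊆T k≤∣L∣ = ≤-trans k≤∣L∣ (≤-trans
      (p⊆q⇒∣p∣≤∣q∣ (∈-preimage⁺ φ ∘ φL⊆T ∘ ∈-fromList⁻ L)) (≤-reflexive (∣preimage∣ π T)))

    module _ (A : Subset 9) {ys} (ys∈ : ys ∈ₗ sublists (elements (preimage φ A))) where

      image-unique : Unique (map φ ys)
      image-unique = map⁺ (Injection.injective (↔⇒↣ π)) (sublist-unique (elements-unique (preimage φ A)) ys∈)

      image-⊆ : ∀ {x} → x ∈ₗ map φ ys → x ∈ A
      image-⊆ x∈ with y , y∈ys , refl ← ∈-map⁻ φ x∈ =
        ∈-preimage⁻ φ (∈-elements⁻ (sublist-⊆ (elements (preimage φ A)) ys∈ y∈ys))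

    φ[Σ-list] : ∀ A {x} → x ∈ₗ Σ-list _⊕_ (preimage φ A) → φ x ∈ subsetSums _+_ 0# A
    φ[Σ-list] A x∈ =
      let ys , ys∈ , 1≤∣ys∣ , x≡∑ys =
            ∈-sublistSums⁻ _⊕_ zero (λ ys → 1 ≤? length ys) (elements (preimage φ A)) x∈
      in subst (_∈ subsetSums _+_ 0# A) (sym (trans (cong φ x≡∑ys) (φ-sum ys)))
           (sum∈subsetSums (image-unique A ys∈) (≤-trans 1≤∣ys∣ (≤-reflexive (sym (length-map φ ys))))
             (image-⊆ A ys∈))

    φ[Σ₂-list] : ∀ A {x} → x ∈ₗ Σ₂-list _⊕_ (preimage φ A) → φ x ∈ rSums _+_ 0# 2 A
    φ[Σ₂-list] A x∈ =
      let ys , ys∈ , ∣ys∣≡2 , x≡∑ys =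
            ∈-sublistSums⁻ _⊕_ zero (λ ys → length ys ℕ.≟ 2) (elements (preimage φ A)) x∈
      in subst (_∈ rSums _+_ 0# 2 A) (sym (trans (cong φ x≡∑ys) (φ-sum ys)))
           (sum∈rSums (image-unique A ys∈) (trans (length-map φ ys) ∣ys∣≡2) (image-⊆ A ys∈))

    φ[translates] : ∀ A {B b b′ x} → φ b ∈ B → φ b′ ∈ B →
                    x ∈ₗ translates _⊕_ (preimage φ A) b b′ → φ x ∈ sumset _+_ 0# A B
    φ[translates] A {B} {b} {b′} φb∈B φb′∈B x∈ =
      let a , c , a∈ , c∈ , x≡a⊕c = ∈-cartesianProductWith⁻ _⊕_ (elements (preimage φ A)) (b ∷ b′ ∷ []) x∈
      in subst (_∈ sumset _+_ 0# A B) (sym (trans (cong φ x≡a⊕c) (homo a c)))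
           (∈-sumset (∈-preimage⁻ φ (∈-elements⁻ a∈)) (φc∈B c∈))
      where
      φc∈B : ∀ {c} → c ∈ₗ b ∷ b′ ∷ [] → φ c ∈ B
      φc∈B (here refl)         = φb∈B
      φc∈B (there (here refl)) = φb′∈B

    transfer : Bounds _⊕_ → (A B : Subset 9) →
               (∣ A ∣ ≡ 3 → ZeroSumFree _+_ 0# A → 6 ≤ ∣ subsetSums _+_ 0# A ∣)
               × (∣ A ∣ ≡ 3 → 0# ∉ A → 5 ≤ ∣ subsetSums _+_ 0# A ∣)
               × (∣ A ∣ ≡ 4 → 0# ∉ A → 7 ≤ ∣ subsetSums _+_ 0# A ∣)
               × (∣ A ∣ ≡ 4 → 5 ≤ ∣ rSums _+_ 0# 2 A ∣)
               × (∣ A ∣ ≡ 4 → 2 ≤ ∣ B ∣ → 5 ≤ ∣ sumset _+_ 0# A B ∣)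
    transfer bounds A B =
        (λ ∣A∣≡3 zsf → lower-bound (φ[Σ-list] A)
           (Σ-zeroSumFree A′ (∣A′∣≡ ∣A∣≡3) (zsf ∘ subst (_∈ subsetSums _+_ 0# A) zero↦0# ∘ φ[Σ-list] A)))
      , (λ ∣A∣≡3 0#∉A → lower-bound (φ[Σ-list] A) (Σ-three A′ (∣A′∣≡ ∣A∣≡3) (zero∉A′ 0#∉A)))
      , (λ ∣A∣≡4 0#∉A → lower-bound (φ[Σ-list] A) (Σ-four A′ (∣A′∣≡ ∣A∣≡4) (zero∉A′ 0#∉A)))
      , (λ ∣A∣≡4 → lower-bound (φ[Σ₂-list] A) (Σ₂-four A′ (∣A′∣≡ ∣A∣≡4)))
      , λ ∣A∣≡4 2≤∣B∣ →
          let b , b′ , b≢b′ , b∈B′ , b′∈B′ =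
                two-distinct-elements (preimage φ B) (≤-trans 2≤∣B∣ (≤-reflexive (sym (∣preimage∣ π B))))
          in lower-bound (φ[translates] A (∈-preimage⁻ φ b∈B′) (∈-preimage⁻ φ b′∈B′))
               (translates-four A′ (∣A′∣≡ ∣A∣≡4) b b′ b≢b′)
      where
      open Bounds bounds
      A′ = preimage φ A
      ∣A′∣≡ : ∀ {k} → ∣ A ∣ ≡ k → ∣ A′ ∣ ≡ k
      ∣A′∣≡ = trans (∣preimage∣ π A)
      zero∉A′ : 0# ∉ A → zero ∉ A′
      zero∉A′ 0#∉A = 0#∉A ∘ subst (_∈ A) zero↦0# ∘ ∈-preimage⁻ φ

lemma2p5 : (_+_ : Op₂ (Fin 9)) (0# : Fin 9) (-_ : Op₁ (Fin 9)) →
           IsAbelianGroup _≡_ _+_ 0# -_ →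
           (A B : Subset 9) →
           (∣ A ∣ ≡ 3 → ZeroSumFree _+_ 0# A → 6 ≤ ∣ subsetSums _+_ 0# A ∣)
           × (∣ A ∣ ≡ 3 → 0# ∉ A → 5 ≤ ∣ subsetSums _+_ 0# A ∣)
           × (∣ A ∣ ≡ 4 → 0# ∉ A → 7 ≤ ∣ subsetSums _+_ 0# A ∣)
           × (∣ A ∣ ≡ 4 → 5 ≤ ∣ rSums _+_ 0# 2 A ∣)
           × (∣ A ∣ ≡ 4 → 2 ≤ ∣ B ∣ → 5 ≤ ∣ sumset _+_ 0# A B ∣)
lemma2p5 _+_ 0# -_ isAG =
  [ (λ iso → transfer iso ℤ₉-bounds) , (λ iso → transfer iso ℤ₃×ℤ₃-bounds) ]′ classify
  where open GroupOfOrder9 isAG
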